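{- For every integer $n\geq 9$ there exists a $3$-strong digraph $D$ of order $n$ with minimum degree at least $n+1$ (i.e. $d(x)\geq n+1$ for every vertex $x$) which is not strongly Hamiltonian-connected.
   Context: All digraphs are finite, without loops and without multiple arcs (opposite arcs $xy$ and $yx$ may both be present). For a vertex $x$, $d(x)=d^+(x)+d^-(x)$ is the sum of its out-degree and in-degree. A digraph $D$ is $k$-strong if $|V(D)|\geq k+1$ and $D-A$ is strongly connected for every set $A$ of at most $k-1$ vertices. A path is Hamiltonian if it contains all vertices. A digraph is strongly Hamiltonian-connected if for every ordered pair of distinct vertices $x,y$ there is a Hamiltonian path from $x$ to $y$. -}

module Defs where

open import Data.Nat using (ℕ; zero; suc; _+_; _≤_)
open import Data.Bool using (Bool; true; false; T; if_then_else_)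
open import Data.Fin using (Fin)
open import Data.Fin.Subset using (Subset; _∈_; _∉_; ∣_∣)
open import Data.List using (List; map; allFin; head; last; length)
open import Data.Nat.ListAction using (sum)
open import Data.List.Relation.Unary.Unique.Propositional using (Unique)
open import Data.List.Relation.Unary.Linked using (Linked)
import Data.List.Membership.Propositional as LM
open import Data.Maybe using (Maybe; just)
open import Relation.Binary.PropositionalEquality using (_≡_; _≢_)
open import Data.Product using (_×_)

-- A digraph on the vertex set Fin n: arc x y = true iff xy is an arc.
-- No loops; no multiple arcs (adjacency is a relation); opposite arcs allowed.
record Digraph (n : ℕ) : Set where
  field
    arc      : Fin n → Fin n → Bool
    loopless : ∀ x → arc x x ≡ false
open Digraph public

Arc : ∀ {n} → Digraph n → Fin n → Fin n → Set
Arc D x y = T (arc D x y)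

indicator : Bool → ℕ
indicator b = if b then 1 else 0

outdeg indeg deg : ∀ {n} → Digraph n → Fin n → ℕ
outdeg {n} D x = sum (map (λ y → indicator (arc D x y)) (allFin n))
indeg  {n} D x = sum (map (λ y → indicator (arc D y x)) (allFin n))
deg D x = outdeg D x + indeg D x

data ReachAvoiding {n} (D : Digraph n) (A : Subset n) : Fin n → Fin n → Set where
  here : ∀ {x} → ReachAvoiding D A x x
  step : ∀ {x y z} → Arc D x z → z ∉ A → ReachAvoiding D A z y → ReachAvoiding D A x y

StrongMinus : ∀ {n} → Digraph n → Subset n → Set
StrongMinus D A = ∀ x y → x ∉ A → y ∉ A → ReachAvoiding D A x y

-- k-strong: |V(D)| ≥ k+1 and D - A strong for every A with |A| ≤ k-1
-- (written |A| + 1 ≤ k, i.e. |A| < k).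
KStrong : ∀ {n} → ℕ → Digraph n → Set
KStrong {n} k D = (suc k ≤ n) × (∀ (A : Subset n) → suc ∣ A ∣ ≤ k → StrongMinus D A)

record HamPath {n} (D : Digraph n) (x y : Fin n) : Set where
  field
    path   : List (Fin n)
    unique : Unique path
    covers : ∀ v → v LM.∈ path
    arcs   : Linked (Arc D) path
    start  : head path ≡ just x
    end    : last path ≡ just y

StronglyHamConnected : ∀ {n} → Digraph n → Set
StronglyHamConnected {n} D = ∀ (x y : Fin n) → x ≢ y → HamPath D x y

module Submission where

-- For n = 9 + k the digraph G k blows up a pattern on eight classes: single vertices
-- x, y, a, b, c, d, a complete digraph R on three vertices and a complete digraph S on
-- k vertices; the arcs between classes are listed in `out`.
--  * Degrees are counted directly: each vertex outside S has at least ten arcs to and from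
--    the other nine vertices and is joined to all of S in one direction.
--  * 3-strong: after deleting at most two vertices, x, y or a is a hub; where a deleted
--    vertex could cut a connection, two routes exist that one more vertex cannot both block.
--  * There is no Hamiltonian path from x to y.  Along such a path, record the current
--    class and the classes met so far; single classes cannot be met twice.  A finite list
--    of these states that contains the start and is closed under the possible moves, but
--    contains no state at y with every class met, excludes the path.  Such a list is found
--    by breadth-first search and its properties are checked by evaluation.

open import Defs
open import Data.Nat using (ℕ; zero; suc; _+_; _≤_; _<_; _≤ᵇ_; z≤n; s≤s)
open import Data.Nat.Properties
  using (≤-trans; ≤-reflexive; m≤m+n; m≤n+m; +-mono-≤; +-monoʳ-≤; +-comm; ≤ᵇ⇒≤; <⇒≱;
         m≤n⇒∃[o]m+o≡n; module ≤-Reasoning)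
open import Data.Nat.ListAction using (sum)
open import Data.Bool using (Bool; true; false; not; _∧_; T)
open import Data.Bool.Properties using (T-∧)
open import Data.Empty using (⊥; ⊥-elim)
open import Data.Unit using (tt)
open import Data.Fin using (Fin; zero; suc; _≟_)
open import Data.Fin.Subset using (Subset; _∈_; _∉_; ∣_∣; ⁅_⁆; _∪_; _-_)
open import Data.Fin.Subset.Properties
  using (_∈?_; x∈⁅x⁆; x∈⁅y⁆⇒x≡y; x∈p∪q⁺; x∈p∪q⁻; x∈p∧x∉q⇒x∈p─q; x≢y⇒x∉⁅y⁆; x∈p⇒∣p-x∣<∣p∣)
open import Data.List using (List; []; _∷_; _++_; map; filter; concatMap; tabulate; allFin; length; last)
open import Data.List.Relation.Unary.All as All using (All; []; _∷_; all?)
open import Data.List.Relation.Unary.All.Properties using (¬Any⇒All¬; ++⁻ˡ; ++⁻ʳ)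
open import Data.List.Relation.Unary.Any using (Any; here; there; any?)
open import Data.List.Relation.Unary.AllPairs using ([]; _∷_)
open import Data.List.Relation.Unary.Linked using (Linked; _∷_)
open import Data.List.Relation.Unary.Unique.Propositional using (Unique)
open import Data.List.Membership.Propositional using (find) renaming (_∈_ to _∈ₗ_)
open import Data.List.Membership.Propositional.Properties using (∈-allFin)
import Data.List.Membership.DecPropositional as DecMembership
open import Data.Maybe using (just)
open import Data.Product using (Σ; ∃; _×_; _,_; proj₁; proj₂)
open import Data.Product.Properties using (≡-dec)
open import Data.Sum using (_⊎_; inj₁; inj₂)
import Data.Vec.Properties as Vec
import Data.Fin.Properties as Fin
open import Function using (_∘_; Equivalence)
open import Relation.Binary.PropositionalEquality using (_≡_; _≢_; refl; sym; cong; subst; module ≡-Reasoning)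
open import Relation.Nullary using (¬_; Dec; yes; no; does)
open import Relation.Nullary.Decidable using (dec-true; dec-false; toWitness; True; T?; ¬?; _×-dec_; _→-dec_)
open import Algebra.Properties.CommutativeSemigroup Data.Nat.Properties.+-commutativeSemigroup
  using (interchange)

distinct-members : ∀ {n} {A : Subset n} {xs : List (Fin n)} →
                   Unique xs → All (_∈ A) xs → length xs ≤ ∣ A ∣
distinct-members [] [] = z≤n
distinct-members {A = A} {x ∷ xs} (x∉xs ∷ unique) (x∈A ∷ xs⊆A) =
  ≤-trans (s≤s (distinct-members unique (All.zipWith stays (x∉xs , xs⊆A)))) (x∈p⇒∣p-x∣<∣p∣ x∈A)
  where
  stays : ∀ {y} → x ≢ y × y ∈ A → y ∈ A - x
  stays (x≢y , y∈A) = x∈p∧x∉q⇒x∈p─q y∈A (x≢y⇒x∉⁅y⁆ (x≢y ∘ sym))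

no-three-members : ∀ {n} {A : Subset n} {p q r : Fin n} → ∣ A ∣ < 3 →
                   Unique (p ∷ q ∷ r ∷ []) → p ∈ A → q ∈ A → r ∈ A → ⊥
no-three-members small distinct p∈A q∈A r∈A =
  <⇒≱ small (distinct-members distinct (p∈A ∷ q∈A ∷ r∈A ∷ []))

distinct-triple : ∀ {n} {z p q : Fin n} {ps qs : List (Fin n)} →
                  Unique (z ∷ ps ++ qs) → p ∈ₗ ps → q ∈ₗ qs → Unique (z ∷ p ∷ q ∷ [])
distinct-triple {ps = ps} (z∉ ∷ unique) p∈ps q∈qs =
  (All.lookup (++⁻ˡ ps z∉) p∈ps ∷ All.lookup (++⁻ʳ ps z∉) q∈qs ∷ [])
  ∷ (apart unique p∈ps q∈qs ∷ []) ∷ [] ∷ []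
  where
  apart : ∀ {p q ps qs} → Unique (ps ++ qs) → p ∈ₗ ps → q ∈ₗ qs → p ≢ q
  apart {ps = _ ∷ ps} (p∉ ∷ _) (here refl) q∈qs = All.lookup (++⁻ʳ ps p∉) q∈qs
  apart (_ ∷ unique) (there p∈ps) q∈qs = apart unique p∈ps q∈qs

module Avoiding {n} (D : Digraph n) (A : Subset n) where

  _⇝_ : Fin n → Fin n → Set
  _⇝_ = ReachAvoiding D A

  ⇝-trans : ∀ {u v w} → u ⇝ v → v ⇝ w → u ⇝ w
  ⇝-trans here q = q
  ⇝-trans (step uv v∉A p) q = step uv v∉A (⇝-trans p q)

  via-hub : ∀ h → (∀ u → u ∉ A → u ⇝ h) → (∀ v → v ∉ A → h ⇝ v) → StrongMinus D A
  via-hub h to-h from-h u v u∉A v∉A = ⇝-trans (to-h u u∉A) (from-h v v∉A)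

  isRoute : Fin n → List (Fin n) → Fin n → Bool
  isRoute s []       t = arc D s t
  isRoute s (p ∷ ps) t = arc D s p ∧ isRoute p ps t

  route-⇝ : ∀ {s t} ps → T (isRoute s ps t) → All (_∉ A) ps → t ∉ A → s ⇝ t
  route-⇝ []       st      []            t∉A = step st t∉A here
  route-⇝ (p ∷ ps) route   (p∉A ∷ ps∉A) t∉A =
    step (proj₁ sp,pt) p∉A (route-⇝ ps (proj₂ sp,pt) ps∉A t∉A)
    where sp,pt = Equivalence.to T-∧ route

  two-routes : ∀ {s t z} → ∣ A ∣ < 3 → z ∈ A → (ps qs : List (Fin n)) →
               Unique (z ∷ ps ++ qs) → T (isRoute s ps t) → T (isRoute s qs t) → t ∉ A → s ⇝ t
  two-routes small z∈A ps qs distinct ps-route qs-route t∉A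
    with any? (_∈? A) ps | any? (_∈? A) qs
  ... | no ps-free | _ = route-⇝ ps ps-route (¬Any⇒All¬ ps ps-free) t∉A
  ... | yes _ | no qs-free = route-⇝ qs qs-route (¬Any⇒All¬ qs qs-free) t∉A
  ... | yes ps-blocked | yes qs-blocked =
    let p , p∈ps , p∈A = find ps-blocked
        q , q∈qs , q∈A = find qs-blocked
    in ⊥-elim (no-three-members small (distinct-triple distinct p∈ps q∈qs) z∈A p∈A q∈A)

sum-ones : ∀ {n} k (h : Fin k → Fin n) (g : Fin n → ℕ) →
           (∀ i → g (h i) ≡ 1) → sum (map g (tabulate h)) ≡ k
sum-ones zero    h g ones = refl
sum-ones (suc k) h g ones rewrite ones zero = cong suc (sum-ones k (h ∘ suc) g (ones ∘ suc))

sum-ones-but-one : ∀ {n} k (j : Fin k) (h : Fin k → Fin n) (g : Fin n → ℕ) →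
                   (∀ i → j ≢ i → g (h i) ≡ 1) → k ≤ suc (sum (map g (tabulate h)))
sum-ones-but-one (suc k) zero h g ones
  rewrite sum-ones k (h ∘ suc) g (λ i → ones (suc i) (λ ())) = s≤s (m≤n+m k (g (h zero)))
sum-ones-but-one (suc k) (suc j) h g ones rewrite ones zero (λ ()) =
  s≤s (sum-ones-but-one k j (h ∘ suc) g (λ i j≢i → ones (suc i) (j≢i ∘ Fin.suc-injective)))

blowUp : ∀ {n m} → (Fin n → Fin m) → (Fin m → Fin m → Bool) → Digraph n
blowUp cls H = record
  { arc      = λ u v → not (does (u ≟ v)) ∧ H (cls u) (cls v)
  ; loopless = λ u → cong (λ b → not b ∧ H (cls u) (cls u)) (dec-true (u ≟ u) refl)
  }

blowUp-arc : ∀ {n m} (cls : Fin n → Fin m) H u v → Arc (blowUp cls H) u v → T (H (cls u) (cls v))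
blowUp-arc cls H u v uv = proj₂ (Equivalence.to T-∧ uv)

last-∈ : ∀ {A : Set} {xs : List A} {y : A} → last xs ≡ just y → y ∈ₗ xs
last-∈ {xs = _ ∷ []}     refl = here refl
last-∈ {xs = _ ∷ _ ∷ xs} end  = there (last-∈ {xs = _ ∷ xs} end)

-- Running along a Hamiltonian path from x to y we record the class
-- of the current vertex and the set of classes met so far; a single class can be met only
-- once, and the class of y (assumed single) is met only at the very end.  A list of states
-- that contains the start, is closed under these moves and never reaches the class of y
-- with all classes met is therefore a certificate that no Hamiltonian path x → y exists.
module ClassWalks
  {n m : ℕ} (D : Digraph n) (cls : Fin n → Fin m)
  (H : Fin m → Fin m → Bool) (single : Fin m → Bool)
  (arc-in-pattern : ∀ u v → Arc D u v → T (H (cls u) (cls v)))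
  (single-unique : ∀ {u v} → T (single (cls u)) → cls u ≡ cls v → u ≡ v)
  where

  State : Set
  State = Fin m × Subset m

  _≟ˢ_ : (s t : State) → Dec (s ≡ t)
  _≟ˢ_ = ≡-dec _≟_ (Vec.≡-dec Data.Bool._≟_)

  open DecMembership _≟ˢ_ using () renaming (_∈?_ to _∈ₗ?_)

  initial : Fin n → State
  initial x = cls x , ⁅ cls x ⁆

  next : State → Fin m → State
  next (_ , V) σ = σ , V ∪ ⁅ σ ⁆

  Move : Fin m → State → Fin m → Set
  Move f (ℓ , V) σ = ℓ ≢ f × T (H ℓ σ) × (T (single σ) → σ ∉ V)

  move? : ∀ f s σ → Dec (Move f s σ)
  move? f (ℓ , V) σ = ¬? (ℓ ≟ f) ×-dec T? (H ℓ σ) ×-dec (T? (single σ) →-dec ¬? (σ ∈? V))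

  record Certificate (x y : Fin n) (L : List State) : Set where
    field
      starts     : initial x ∈ₗ L
      closed     : ∀ {s} σ → s ∈ₗ L → Move (cls y) s σ → next s σ ∈ₗ L
      incomplete : ∀ {V} → (cls y , V) ∈ₗ L → ∃ λ u → cls u ∉ V

  -- Invariant along the path: V holds the classes of the vertices already passed, no
  -- vertex still to come lies in a single class of V, and every vertex is still to come
  -- or has its class in V.
  record Tracks (V : Subset m) (rest : List (Fin n)) : Set where
    field
      fresh    : ∀ {w} → w ∈ₗ rest → T (single (cls w)) → cls w ∉ V
      recorded : ∀ u → u ∈ₗ rest ⊎ cls u ∈ V

  module _ {x y L} (cert : Certificate x y L) (single-y : T (single (cls y))) where
    open Certificate cert

    -- Following the rest of the path keeps the state inside L; at the end all classes are met.
    follow : ∀ v rest {V} → (cls v , V) ∈ₗ L → Tracks V rest →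
             Unique (v ∷ rest) → Linked (Arc D) (v ∷ rest) → last (v ∷ rest) ≡ just y → ⊥
    follow v [] state∈L tracks _ _ refl with incomplete state∈L
    ... | u , u∉V with Tracks.recorded tracks u
    ...   | inj₁ ()
    ...   | inj₂ u∈V = u∉V u∈V
    follow v (w ∷ rest) {V} state∈L tracks (v∉ ∷ unique@(w∉rest ∷ _)) (v→w ∷ arcs) end =
      follow w rest (closed (cls w) state∈L move) tracks′ unique arcs end
      where
      v≢y : v ≢ y
      v≢y = All.lookup v∉ (last-∈ end)
      move : Move (cls y) (cls v , V) (cls w)
      move = (λ e → v≢y (single-unique (subst (T ∘ single) (sym e) single-y) e))
           , arc-in-pattern v w v→w
           , Tracks.fresh tracks (here refl)
      tracks′ : Tracks (V ∪ ⁅ cls w ⁆) rest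
      Tracks.fresh tracks′ w′∈rest single-w′ w′∈ with x∈p∪q⁻ V ⁅ cls w ⁆ w′∈
      ... | inj₁ w′∈V = Tracks.fresh tracks (there w′∈rest) single-w′ w′∈V
      ... | inj₂ w′∈w = All.lookup w∉rest w′∈rest
                          (sym (single-unique single-w′ (x∈⁅y⁆⇒x≡y (cls w) w′∈w)))
      Tracks.recorded tracks′ u with Tracks.recorded tracks u
      ... | inj₁ (here refl)  = inj₂ (x∈p∪q⁺ (inj₂ (x∈⁅x⁆ (cls u))))
      ... | inj₁ (there u∈rest) = inj₁ u∈rest
      ... | inj₂ u∈V = inj₂ (x∈p∪q⁺ (inj₁ u∈V))

    no-hamiltonian-path : ¬ HamPath D x y
    no-hamiltonian-path record { path = [] ; start = () }
    no-hamiltonian-path record { path = .x ∷ rest ; unique = unique@(x∉rest ∷ _) ; covers = covers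
                               ; arcs = arcs ; start = refl ; end = end } =
      follow x rest starts tracks unique arcs end
      where
      tracks : Tracks ⁅ cls x ⁆ rest
      Tracks.fresh tracks w∈rest single-w w∈x =
        All.lookup x∉rest w∈rest (sym (single-unique single-w (x∈⁅y⁆⇒x≡y (cls x) w∈x)))
      Tracks.recorded tracks u with covers u
      ... | here refl = inj₂ (x∈⁅x⁆ (cls x))
      ... | there u∈rest = inj₁ u∈rest

  -- The certificate conditions in decidable form; the vertices ws witness the classes
  -- that a state at the class of y fails to meet.
  Checked : Fin n → Fin n → List (Fin n) → List State → Set
  Checked x y ws L =
    initial x ∈ₗ L
    × All (λ s → All (λ σ → Move (cls y) s σ → next s σ ∈ₗ L) (allFin m)) L
    × All (λ s → proj₁ s ≡ cls y → Any (λ u → cls u ∉ proj₂ s) ws) L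

  checked? : ∀ x y ws L → Dec (Checked x y ws L)
  checked? x y ws L =
    initial x ∈ₗ? L
    ×-dec all? (λ s → all? (λ σ → move? (cls y) s σ →-dec next s σ ∈ₗ? L) (allFin m)) L
    ×-dec all? (λ s → (proj₁ s ≟ cls y) →-dec any? (λ u → ¬? (cls u ∈? proj₂ s)) ws) L

  certificate : ∀ {x y ws L} → Checked x y ws L → Certificate x y L
  certificate (starts , closed , incomplete) = record
    { starts     = starts
    ; closed     = λ σ s∈L move → All.lookup (All.lookup closed s∈L) (∈-allFin σ) move
    ; incomplete = λ s∈L → let u , _ , u∉V = find (All.lookup incomplete s∈L refl) in u , u∉V
    }

  -- Breadth-first search for the states reachable from the start; it produces the
  -- candidate list L, whose properties are then checked by checked?.
  successors : Fin m → State → List State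
  successors f s = map (next s) (filter (move? f s) (allFin m))

  add-new : List State → List State → List State → List State × List State
  add-new seen new []       = seen , new
  add-new seen new (s ∷ ss) with does (s ∈ₗ? seen)
  ... | true  = add-new seen new ss
  ... | false = add-new (s ∷ seen) (s ∷ new) ss

  explore : Fin m → ℕ → List State → List State → List State
  explore f zero       seen frontier = seen
  explore f (suc fuel) seen frontier with add-new seen [] (concatMap (successors f) frontier)
  ... | seen′ , new = explore f fuel seen′ new

  -- The states found within the given number of rounds; the number only has to be large
  -- enough for checked? to succeed.
  reachable : Fin n → Fin n → ℕ → List State
  reachable x y fuel = explore (cls y) fuel (initial x ∷ []) (initial x ∷ [])

pattern cx = zero
pattern cy = suc cx
pattern ca = suc cy
pattern cb = suc ca
pattern cc = suc cb
pattern cd = suc cc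
pattern cR = suc cd
pattern cS = suc cR

pattern vx = zero
pattern vy = suc vx
pattern va = suc vy
pattern vb = suc va
pattern vc = suc vb
pattern vd = suc vc
pattern r₀ = suc vd
pattern r₁ = suc r₀
pattern r₂ = suc r₁
pattern sv i = suc (suc (suc (suc (suc (suc (suc (suc (suc i))))))))

cls : ∀ {k} → Fin (9 + k) → Fin 8
cls vx     = cx
cls vy     = cy
cls va     = ca
cls vb     = cb
cls vc     = cc
cls vd     = cd
cls r₀     = cR
cls r₁     = cR
cls r₂     = cR
cls (sv _) = cS

-- The classes each class sends arcs to (R and S induce complete digraphs).
out : Fin 8 → List (Fin 8)
out cx = cy ∷ ca ∷ cc ∷ []
out cy = cx ∷ ca ∷ cb ∷ cc ∷ cd ∷ cR ∷ cS ∷ []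
out ca = cx ∷ cy ∷ cb ∷ cc ∷ cd ∷ []
out cb = cx ∷ cy ∷ ca ∷ cc ∷ cR ∷ cS ∷ []
out cc = cx ∷ ca ∷ cd ∷ []
out cd = cx ∷ ca ∷ cb ∷ cR ∷ cS ∷ []
out cR = cx ∷ cc ∷ cd ∷ cR ∷ []
out cS = cx ∷ ca ∷ cb ∷ cc ∷ cd ∷ cR ∷ cS ∷ []

Pattern : Fin 8 → Fin 8 → Bool
Pattern σ τ = does (τ ∈ₗ? out σ)
  where open DecMembership {A = Fin 8} _≟_ using () renaming (_∈?_ to _∈ₗ?_)

G : ∀ k → Digraph (9 + k)
G k = blowUp cls Pattern

single : Fin 8 → Bool
single cR = false
single cS = false
single _  = true

module _ {k : ℕ} where

  -- The vertex of a single class (the value on R and S is irrelevant).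
  vertex : Fin 8 → Fin (9 + k)
  vertex cx = vx
  vertex cy = vy
  vertex ca = va
  vertex cb = vb
  vertex cc = vc
  vertex cd = vd
  vertex _  = r₀

  vertex-cls : ∀ u → T (single (cls u)) → u ≡ vertex (cls u)
  vertex-cls vx _ = refl
  vertex-cls vy _ = refl
  vertex-cls va _ = refl
  vertex-cls vb _ = refl
  vertex-cls vc _ = refl
  vertex-cls vd _ = refl
  vertex-cls r₀ ()
  vertex-cls r₁ ()
  vertex-cls r₂ ()
  vertex-cls (sv _) ()

  single-unique : ∀ {u v} → T (single (cls u)) → cls u ≡ cls v → u ≡ v
  single-unique {u} {v} single-u same = begin
    u               ≡⟨ vertex-cls u single-u ⟩
    vertex (cls u)  ≡⟨ cong vertex same ⟩
    vertex (cls v)  ≡⟨ vertex-cls v (subst (T ∘ single) same single-u) ⟨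
    v               ∎
    where open ≡-Reasoning

-- Degrees in G k.  The arcs of a vertex split into those to and from the nine vertices
-- x … r₂, counted by evaluation, and those to and from the block S.
module Degrees (k : ℕ) where
  out-block in-block : Fin (9 + k) → ℕ
  out-block u = sum (map (λ v → indicator (arc (G k) u v)) (tabulate {n = k} (λ i → sv i)))
  in-block  u = sum (map (λ v → indicator (arc (G k) v u)) (tabulate {n = k} (λ i → sv i)))

  core-degree : ∀ u a b → T (10 ≤ᵇ a + b) → k ≤ out-block u + in-block u →
                9 + k + 1 ≤ (a + out-block u) + (b + in-block u)
  core-degree u a b core block = begin
    9 + k + 1                                ≡⟨ cong (9 +_) (+-comm k 1) ⟩
    10 + k                                   ≤⟨ +-mono-≤ (≤ᵇ⇒≤ 10 (a + b) core) block ⟩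
    (a + b) + (out-block u + in-block u)     ≡⟨ interchange a b (out-block u) (in-block u) ⟩
    (a + out-block u) + (b + in-block u)     ∎
    where open ≤-Reasoning

  out-to-block : ∀ u → (∀ i → arc (G k) u (sv i) ≡ true) → k ≤ out-block u + in-block u
  out-to-block u arcs = ≤-trans (≤-reflexive (sym (sum-ones k _ _ (λ i → cong indicator (arcs i)))))
                                (m≤m+n (out-block u) (in-block u))

  in-from-block : ∀ u → (∀ i → arc (G k) (sv i) u ≡ true) → k ≤ out-block u + in-block u
  in-from-block u arcs = ≤-trans (≤-reflexive (sym (sum-ones k _ _ (λ i → cong indicator (arcs i)))))
                                 (m≤n+m (in-block u) (out-block u))

  -- A block vertex has 8 + 3 arcs to and from the first nine vertices and is joined in
  -- both directions to the other k - 1 block vertices.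
  block-degree : ∀ tO tI → k ≤ suc tO → 9 + k + 1 ≤ (8 + tO) + (3 + tI)
  block-degree tO tI block = begin
    9 + k + 1            ≡⟨ cong (9 +_) (+-comm k 1) ⟩
    10 + k               ≤⟨ +-monoʳ-≤ 10 block ⟩
    11 + tO              ≡⟨ cong (8 +_) (+-comm 3 tO) ⟩
    8 + (tO + 3)         ≤⟨ +-monoʳ-≤ 8 (+-monoʳ-≤ tO (m≤m+n 3 tI)) ⟩
    (8 + tO) + (3 + tI)  ∎
    where open ≤-Reasoning

  -- The numbers a, b are the arcs from u to, and into u from, the nine vertices x … r₂.
  degree : ∀ u → 9 + k + 1 ≤ deg (G k) u
  degree vx = core-degree vx 3 8 tt (in-from-block vx (λ _ → refl))
  degree vy = core-degree vy 8 3 tt (out-to-block vy (λ _ → refl))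
  degree va = core-degree va 5 5 tt (in-from-block va (λ _ → refl))
  degree vb = core-degree vb 7 3 tt (out-to-block vb (λ _ → refl))
  degree vc = core-degree vc 3 7 tt (in-from-block vc (λ _ → refl))
  degree vd = core-degree vd 6 6 tt (out-to-block vd (λ _ → refl))
  degree r₀ = core-degree r₀ 5 5 tt (in-from-block r₀ (λ _ → refl))
  degree r₁ = core-degree r₁ 5 5 tt (in-from-block r₁ (λ _ → refl))
  degree r₂ = core-degree r₂ 5 5 tt (in-from-block r₂ (λ _ → refl))
  degree (sv j) = block-degree (out-block (sv j)) (in-block (sv j))
    (sum-ones-but-one k j _ _ (λ i j≢i → cong (λ b → indicator (not b ∧ true)) (dec-false (j ≟ i) j≢i)))

-- Every vertex has an
-- arc to x, y has an arc to every vertex, and x → y, so if x, y ∉ A then x is a hub of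
-- G k - A.  If A contains exactly one of them, the other one is a hub, now reached along
-- one of two routes that the second vertex of A cannot both block; if A = {x, y}, a is a hub.
module Connectivity (k : ℕ) (A : Subset (9 + k)) (small : ∣ A ∣ < 3) where
  open Avoiding (G k) A
  open import Data.List.Relation.Unary.Unique.DecPropositional {A = Fin (9 + k)} _≟_ using (unique?)

  distinct : ∀ {zs : List (Fin (9 + k))} → True (unique? zs) → Unique zs
  distinct = toWitness

  to-x : vx ∉ A → ∀ u → u ⇝ vx
  to-x x∉A vx = here
  to-x x∉A vy = step tt x∉A here
  to-x x∉A va = step tt x∉A here
  to-x x∉A vb = step tt x∉A here
  to-x x∉A vc = step tt x∉A here
  to-x x∉A vd = step tt x∉A here
  to-x x∉A r₀ = step tt x∉A here
  to-x x∉A r₁ = step tt x∉A here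
  to-x x∉A r₂ = step tt x∉A here
  to-x x∉A (sv _) = step tt x∉A here

  from-y : ∀ v → v ∉ A → vy ⇝ v
  from-y vx v∉A = step tt v∉A here
  from-y vy v∉A = here
  from-y va v∉A = step tt v∉A here
  from-y vb v∉A = step tt v∉A here
  from-y vc v∉A = step tt v∉A here
  from-y vd v∉A = step tt v∉A here
  from-y r₀ v∉A = step tt v∉A here
  from-y r₁ v∉A = step tt v∉A here
  from-y r₂ v∉A = step tt v∉A here
  from-y (sv _) v∉A = step tt v∉A here

  from-x : vy ∈ A → ∀ v → v ∉ A → vx ⇝ v
  from-x y∈A vx v∉A = here
  from-x y∈A vy v∉A = ⊥-elim (v∉A y∈A)
  from-x y∈A va v∉A = step tt v∉A here
  from-x y∈A vb v∉A = two-routes small y∈A (va ∷ []) (vc ∷ vd ∷ []) (distinct tt) tt tt v∉A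
  from-x y∈A vc v∉A = step tt v∉A here
  from-x y∈A vd v∉A = two-routes small y∈A (va ∷ []) (vc ∷ []) (distinct tt) tt tt v∉A
  from-x y∈A r₀ v∉A = two-routes small y∈A (va ∷ vb ∷ []) (vc ∷ vd ∷ []) (distinct tt) tt tt v∉A
  from-x y∈A r₁ v∉A = two-routes small y∈A (va ∷ vb ∷ []) (vc ∷ vd ∷ []) (distinct tt) tt tt v∉A
  from-x y∈A r₂ v∉A = two-routes small y∈A (va ∷ vb ∷ []) (vc ∷ vd ∷ []) (distinct tt) tt tt v∉A
  from-x y∈A (sv _) v∉A = two-routes small y∈A (va ∷ vb ∷ []) (vc ∷ vd ∷ []) (distinct tt) tt tt v∉A

  to-y : vx ∈ A → vy ∉ A → ∀ u → u ∉ A → u ⇝ vy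
  to-y x∈A y∉A vx u∉A = ⊥-elim (u∉A x∈A)
  to-y x∈A y∉A vy u∉A = here
  to-y x∈A y∉A va u∉A = step tt y∉A here
  to-y x∈A y∉A vb u∉A = step tt y∉A here
  to-y x∈A y∉A vc u∉A = two-routes small x∈A (va ∷ []) (vd ∷ vb ∷ []) (distinct tt) tt tt y∉A
  to-y x∈A y∉A vd u∉A = two-routes small x∈A (va ∷ []) (vb ∷ []) (distinct tt) tt tt y∉A
  to-y x∈A y∉A r₀ u∉A = two-routes small x∈A (vc ∷ va ∷ []) (vd ∷ vb ∷ []) (distinct tt) tt tt y∉A
  to-y x∈A y∉A r₁ u∉A = two-routes small x∈A (vc ∷ va ∷ []) (vd ∷ vb ∷ []) (distinct tt) tt tt y∉A
  to-y x∈A y∉A r₂ u∉A = two-routes small x∈A (vc ∷ va ∷ []) (vd ∷ vb ∷ []) (distinct tt) tt tt y∉A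
  to-y x∈A y∉A (sv _) u∉A = two-routes small x∈A (va ∷ []) (vb ∷ []) (distinct tt) tt tt y∉A

  module _ (x∈A : vx ∈ A) (y∈A : vy ∈ A) where
    survives : ∀ v → True (unique? (vx ∷ vy ∷ v ∷ [])) → v ∉ A
    survives v different v∈A = no-three-members small (distinct different) x∈A y∈A v∈A

    to-a : ∀ u → u ∉ A → u ⇝ va
    to-a vx u∉A = ⊥-elim (u∉A x∈A)
    to-a vy u∉A = ⊥-elim (u∉A y∈A)
    to-a va u∉A = here
    to-a vb u∉A = step tt (survives va tt) here
    to-a vc u∉A = step tt (survives va tt) here
    to-a vd u∉A = step tt (survives va tt) here
    to-a r₀ u∉A = step tt (survives vc tt) (step tt (survives va tt) here)
    to-a r₁ u∉A = step tt (survives vc tt) (step tt (survives va tt) here)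
    to-a r₂ u∉A = step tt (survives vc tt) (step tt (survives va tt) here)
    to-a (sv _) u∉A = step tt (survives va tt) here

    from-a : ∀ v → v ∉ A → va ⇝ v
    from-a vx v∉A = ⊥-elim (v∉A x∈A)
    from-a vy v∉A = ⊥-elim (v∉A y∈A)
    from-a va v∉A = here
    from-a vb v∉A = step tt v∉A here
    from-a vc v∉A = step tt v∉A here
    from-a vd v∉A = step tt v∉A here
    from-a r₀ v∉A = step tt (survives vb tt) (step tt v∉A here)
    from-a r₁ v∉A = step tt (survives vb tt) (step tt v∉A here)
    from-a r₂ v∉A = step tt (survives vb tt) (step tt v∉A here)
    from-a (sv _) v∉A = step tt (survives vb tt) (step tt v∉A here)

  strong : StrongMinus (G k) A
  strong with vx ∈? A | vy ∈? A
  ... | no x∉A  | no y∉A  = via-hub vx (λ u _ → to-x x∉A u) (λ v v∉A → step tt y∉A (from-y v v∉A))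
  ... | no x∉A  | yes y∈A = via-hub vx (λ u _ → to-x x∉A u) (from-x y∈A)
  ... | yes x∈A | no y∉A  = via-hub vy (to-y x∈A y∉A) from-y
  ... | yes x∈A | yes y∈A = via-hub va (to-a x∈A y∈A) (from-a x∈A y∈A)

no-xy-path : ∀ k → ¬ HamPath (G k) vx vy
no-xy-path k = no-hamiltonian-path (certificate (toWitness {a? = checked? vx vy witnesses states} tt)) tt
  where
  open ClassWalks (G k) cls Pattern single (blowUp-arc cls Pattern) single-unique
  -- One vertex of each class except S, which is empty when k = 0.
  witnesses : List (Fin (9 + k))
  witnesses = vx ∷ vy ∷ va ∷ vb ∷ vc ∷ vd ∷ r₀ ∷ []
  states : List State
  states = reachable vx vy 20

theorem3p6 : ∀ (n : ℕ) → 9 ≤ n →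
    Σ (Digraph n) (λ D → KStrong 3 D × (∀ (x : Fin n) → n + 1 ≤ deg D x) × ¬ StronglyHamConnected D)
theorem3p6 n 9≤n with m≤n⇒∃[o]m+o≡n 9≤n
... | k , refl =
  G k , (m≤m+n 4 (5 + k) , Connectivity.strong k) , Degrees.degree k
      , λ ham-connected → no-xy-path k (ham-connected vx vy (λ ()))
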